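{- Let $R$ be a commutative ring (with $1\neq 0$), $n\ge 2$ an integer, and $S=\{m_1,\dots,m_n\}$ a set of $n$ pairwise coprime non-zero non-units of $R$, and $m=m_1m_2\cdots m_n$. Let $V$ be the set of perfect divisors of $m$ with respect to $S$, and define $\le$ on $V$ by $a\le b$ iff $a=b$ or $a\mid b$ (in $R$). Then $(V,\le)$ is a partially ordered set, $|V|=2^n-2$, and the perfect divisor graph $\mathrm{pdg}(S)$ is a partial order graph.
   Context: Elements $x,y$ of $R$ are coprime if there are $a,b\in R$ with $ax+by=1$. An element $d$ is a perfect divisor of $m$ with respect to $S$ if $d\neq m$ and $d$ is a product of distinct elements of $S$ (i.e. $d=\prod_{j\in J}m_j$ for some nonempty $J\subseteq\{1,\dots,n\}$). The perfect divisor graph $\mathrm{pdg}(S)$ is the simple undirected graph whose vertex set is the set of perfect divisors of $m$ with respect to $S$, in which distinct vertices $a,b$ are adjacent iff $a\mid b$ or $b\mid a$. A partial order graph is a graph of the form $G_A$ for a poset $(A,\le)$, with vertex set $A$ and distinct $a,b$ adjacent iff $a\le b$ or $b\le a$. -}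

module Defs where

open import Level using (Level; _⊔_)
open import Algebra.Bundles using (CommutativeRing)
import Algebra.Definitions.RawMagma as RawMagmaDefs
open import Data.Nat using (ℕ; zero; suc)
open import Data.Fin using (Fin)
open import Data.Bool using (true; false)
open import Data.Vec using ([]; _∷_)
open import Data.Fin.Subset using (Subset; Nonempty; ⊤)
open import Data.Product using (Σ; ∃; ∃-syntax; _×_; _,_; proj₁)
open import Data.Sum using (_⊎_)
open import Relation.Nullary using (¬_)

module PerfectDivisors {c ℓ : Level} (R : CommutativeRing c ℓ) where
  open CommutativeRing R

  -- divisibility in R:  x ∣ y  iff  ∃ q, q * x ≈ y
  open RawMagmaDefs *-rawMagma public using (_∣_)

  IsUnit : Carrier → Set (c ⊔ ℓ)
  IsUnit x = ∃[ u ] (u * x ≈ 1#)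

  Coprime : Carrier → Carrier → Set (c ⊔ ℓ)
  Coprime x y = ∃[ a ] ∃[ b ] (a * x + b * y ≈ 1#)

  prodOver : ∀ {n} → (Fin n → Carrier) → Subset n → Carrier
  prodOver {zero}  ms []          = 1#
  prodOver {suc n} ms (true  ∷ J) = ms Fin.zero * prodOver (λ i → ms (Fin.suc i)) J
  prodOver {suc n} ms (false ∷ J) = prodOver (λ i → ms (Fin.suc i)) J

  totalProd : ∀ {n} → (Fin n → Carrier) → Carrier
  totalProd ms = prodOver ms ⊤

  IsPerfectDivisor : ∀ {n} → (Fin n → Carrier) → Carrier → Set ℓ
  IsPerfectDivisor ms d =
    (¬ d ≈ totalProd ms) × (Σ (Subset _) λ J → Nonempty J × (d ≈ prodOver ms J))

  PD : ∀ {n} → (Fin n → Carrier) → Set (c ⊔ ℓ)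
  PD ms = Σ Carrier (IsPerfectDivisor ms)

  _≈V_ : ∀ {n} {ms : Fin n → Carrier} → PD ms → PD ms → Set ℓ
  a ≈V b = proj₁ a ≈ proj₁ b

  _≤V_ : ∀ {n} {ms : Fin n → Carrier} → PD ms → PD ms → Set (c ⊔ ℓ)
  a ≤V b = (proj₁ a ≈ proj₁ b) ⊎ (proj₁ a ∣ proj₁ b)

  PdgAdj : ∀ {n} {ms : Fin n → Carrier} → PD ms → PD ms → Set (c ⊔ ℓ)
  PdgAdj a b = (¬ a ≈V b) × ((proj₁ a ∣ proj₁ b) ⊎ (proj₁ b ∣ proj₁ a))

  POGAdj : ∀ {n} {ms : Fin n → Carrier} → (PD ms → PD ms → Set (c ⊔ ℓ)) → PD ms → PD ms → Set (c ⊔ ℓ)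
  POGAdj _⊑_ a b = (¬ a ≈V b) × ((a ⊑ b) ⊎ (b ⊑ a))

module Submission where

-- The whole argument rests on one algebraic fact: for subsets J, K of
-- {1,…,n}, the product ∏_J mⱼ divides ∏_K mₖ only if J ⊆ K.  Indeed, if
-- i ∈ J ∖ K then mᵢ divides ∏_K mₖ and is coprime to it, hence is a unit.
-- Consequently J ↦ ∏_J mⱼ is injective, so divisibility is antisymmetric
-- on perfect divisors and the perfect divisors correspond exactly to the
-- subsets other than ∅ and the whole index set.
--
-- The graph statement is pure logic: comparability under
-- "equal or divides" between distinct vertices is mutual divisibility.

open import Defs
open import Level using (Level; _⊔_)
open import Algebra.Bundles using (CommutativeRing)
open import Data.Nat using (ℕ; _≤_; _^_; _∸_)
open import Data.Fin using (Fin)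
open import Data.Product using (Σ; ∃; ∃-syntax; _×_; _,_; proj₁; proj₂)
open import Relation.Nullary using (¬_)
open import Relation.Binary.PropositionalEquality using (_≡_)
open import Relation.Binary.Structures using (IsPartialOrder)
open import Function.Bundles using (_⇔_)

open import Data.Nat as ℕ using (zero; suc; _<_; s≤s)
import Data.Nat.Properties as ℕ
open import Data.Fin as Fin using (toℕ; fromℕ<; combine; remQuot)
import Data.Fin.Properties as Fin
open import Data.Bool using (Bool; true; false)
open import Data.Vec using ([]; _∷_; here; there)
open import Data.Fin.Subset using (Subset; ⊤; ⊥; _∈_; _⊆_; Nonempty)
open import Data.Fin.Subset.Properties using (_∈?_; ⊆-antisym; ∉⊥; nonempty?; Empty-unique)
open import Data.Sum using (inj₁; inj₂)
open import Function using (_∘_)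
open import Function.Bundles using (Inverse; mk⇔)
open import Relation.Nullary using (yes; no; contradiction)
open import Relation.Binary.PropositionalEquality
  using (_≢_; refl; cong; cong₂; subst; module ≡-Reasoning)
  renaming (sym to ≡-sym; trans to ≡-trans)

module BinaryEncoding where

  -- A subset b ∷ J is encoded as the number 2ⁿ·b + code(J).
  bit : Bool → Fin 2
  bit = Inverse.from Fin.2↔Bool

  unbit : Fin 2 → Bool
  unbit = Inverse.to Fin.2↔Bool

  encode : ∀ {n} → Subset n → Fin (2 ^ n)
  encode []      = Fin.zero
  encode (b ∷ J) = combine (bit b) (encode J)

  decode : ∀ n → Fin (2 ^ n) → Subset n
  decode zero    _ = []
  decode (suc n) k = unbit (proj₁ digits) ∷ decode n (proj₂ digits)
    where digits = remQuot {2} (2 ^ n) k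

  decode-encode : ∀ {n} (J : Subset n) → decode n (encode J) ≡ J
  decode-encode []              = refl
  decode-encode {suc n} (b ∷ J) = cong₂ _∷_
    (≡-trans (cong (unbit ∘ proj₁) digits) (Inverse.strictlyInverseˡ Fin.2↔Bool b))
    (≡-trans (cong (decode n ∘ proj₂) digits) (decode-encode J))
    where digits = Fin.remQuot-combine {2} {2 ^ n} (bit b) (encode J)

  encode-decode : ∀ n (k : Fin (2 ^ n)) → encode (decode n k) ≡ k
  encode-decode zero    Fin.zero = refl
  encode-decode (suc n) k = ≡-trans
    (cong₂ combine (Inverse.strictlyInverseʳ Fin.2↔Bool (proj₁ digits))
                   (encode-decode n (proj₂ digits)))
    (Fin.combine-remQuot {2} (2 ^ n) k)
    where digits = remQuot {2} (2 ^ n) k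

  encode-injective : ∀ {n} {J K : Subset n} → encode J ≡ encode K → J ≡ K
  encode-injective {n} {J} {K} eq = begin
    J                   ≡⟨ decode-encode J ⟨
    decode n (encode J) ≡⟨ cong (decode n) eq ⟩
    decode n (encode K) ≡⟨ decode-encode K ⟩
    K                   ∎
    where open ≡-Reasoning

  decode-injective : ∀ n {k l : Fin (2 ^ n)} → decode n k ≡ decode n l → k ≡ l
  decode-injective n {k} {l} eq = begin
    k                   ≡⟨ encode-decode n k ⟨
    encode (decode n k) ≡⟨ cong encode eq ⟩
    encode (decode n l) ≡⟨ encode-decode n l ⟩
    l                   ∎
    where open ≡-Reasoning

  toℕ-encode-⊥ : ∀ n → toℕ (encode (⊥ {n})) ≡ 0
  toℕ-encode-⊥ zero    = refl
  toℕ-encode-⊥ (suc n) = ≡-trans (Fin.toℕ-combine {2} {2 ^ n} Fin.zero (encode (⊥ {n})))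
    (cong₂ ℕ._+_ (ℕ.*-zeroʳ (2 ^ n)) (toℕ-encode-⊥ n))

  toℕ-encode-⊤ : ∀ n → suc (toℕ (encode (⊤ {n}))) ≡ 2 ^ n
  toℕ-encode-⊤ zero    = refl
  toℕ-encode-⊤ (suc n) = begin
    suc (toℕ (combine {2} {2 ^ n} (bit true) (encode (⊤ {n}))))
      ≡⟨ cong suc (Fin.toℕ-combine {2} {2 ^ n} (bit true) (encode (⊤ {n}))) ⟩
    suc (2 ^ n ℕ.* 1 ℕ.+ toℕ (encode (⊤ {n})))
      ≡⟨ ℕ.+-suc (2 ^ n ℕ.* 1) _ ⟨
    2 ^ n ℕ.* 1 ℕ.+ suc (toℕ (encode (⊤ {n})))
      ≡⟨ cong₂ ℕ._+_ (ℕ.*-identityʳ (2 ^ n)) (toℕ-encode-⊤ n) ⟩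
    2 ^ n ℕ.+ 2 ^ n
      ≡⟨ cong (2 ^ n ℕ.+_) (ℕ.+-identityʳ (2 ^ n)) ⟨
    2 ^ suc n ∎
    where open ≡-Reasoning

module Interior where

  -- k < m − 2 says exactly that k + 1 lies strictly between 0 and m − 1.
  <∸2⇒2+< : ∀ m k → k < m ∸ 2 → 2 ℕ.+ k < m
  <∸2⇒2+< (suc (suc m)) k k<m∸2 = s≤s (s≤s k<m∸2)

  2+<⇒<∸2 : ∀ m k → 2 ℕ.+ k < m → k < m ∸ 2
  2+<⇒<∸2 (suc (suc m)) k (s≤s (s≤s k<m)) = k<m

  interior : ∀ m → Fin (m ∸ 2) → Fin m
  interior m i =
    fromℕ< (ℕ.<-trans (ℕ.n<1+n _) (<∸2⇒2+< m (toℕ i) (Fin.toℕ<n i)))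

  toℕ-interior : ∀ m i → toℕ (interior m i) ≡ suc (toℕ i)
  toℕ-interior m i = Fin.toℕ-fromℕ< _

  interior-injective : ∀ m {i j} → interior m i ≡ interior m j → i ≡ j
  interior-injective m {i} {j} eq = Fin.toℕ-injective (ℕ.suc-injective (begin
    suc (toℕ i)          ≡⟨ toℕ-interior m i ⟨
    toℕ (interior m i)   ≡⟨ cong toℕ eq ⟩
    toℕ (interior m j)   ≡⟨ toℕ-interior m j ⟩
    suc (toℕ j)          ∎))
    where open ≡-Reasoning

  interior-≢first : ∀ m i → toℕ (interior m i) ≢ 0
  interior-≢first m i eq with ≡-trans (≡-sym (toℕ-interior m i)) eq
  ... | ()

  interior-≢last : ∀ m i → suc (toℕ (interior m i)) ≢ m
  interior-≢last m i eq = ℕ.<⇒≢ (<∸2⇒2+< m (toℕ i) (Fin.toℕ<n i))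
    (≡-trans (cong suc (≡-sym (toℕ-interior m i))) eq)

  interior-onto : ∀ m (j : Fin m) → toℕ j ≢ 0 → suc (toℕ j) ≢ m →
                  ∃[ i ] interior m i ≡ j
  interior-onto m j j≢first j≢last with toℕ j in eq
  ... | zero  = contradiction refl j≢first
  ... | suc k = fromℕ< k<m∸2 , Fin.toℕ-injective (begin
      toℕ (interior m (fromℕ< k<m∸2)) ≡⟨ toℕ-interior m _ ⟩
      suc (toℕ (fromℕ< k<m∸2))        ≡⟨ cong suc (Fin.toℕ-fromℕ< k<m∸2) ⟩
      suc k                           ≡⟨ eq ⟨
      toℕ j                           ∎)
    where
    open ≡-Reasoning
    k<m∸2 : k < m ∸ 2
    k<m∸2 = 2+<⇒<∸2 m k (ℕ.≤∧≢⇒< (subst (_< m) eq (Fin.toℕ<n j)) j≢last)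

module ProperSubsets where
  open BinaryEncoding
  open Interior

  properSubset : ∀ n → Fin (2 ^ n ∸ 2) → Subset n
  properSubset n = decode n ∘ interior (2 ^ n)

  properSubset-code : ∀ n i {J} → properSubset n i ≡ J → interior (2 ^ n) i ≡ encode J
  properSubset-code n i eq = ≡-trans (≡-sym (encode-decode n _)) (cong encode eq)

  properSubset-injective : ∀ n {i j} → properSubset n i ≡ properSubset n j → i ≡ j
  properSubset-injective n = interior-injective (2 ^ n) ∘ decode-injective n

  properSubset-≢⊥ : ∀ n i → properSubset n i ≢ ⊥
  properSubset-≢⊥ n i eq = interior-≢first (2 ^ n) i
    (≡-trans (cong toℕ (properSubset-code n i eq)) (toℕ-encode-⊥ n))

  properSubset-≢⊤ : ∀ n i → properSubset n i ≢ ⊤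
  properSubset-≢⊤ n i eq = interior-≢last (2 ^ n) i
    (≡-trans (cong (suc ∘ toℕ) (properSubset-code n i eq)) (toℕ-encode-⊤ n))

  properSubset-onto : ∀ n (J : Subset n) → J ≢ ⊥ → J ≢ ⊤ → ∃[ i ] properSubset n i ≡ J
  properSubset-onto n J J≢⊥ J≢⊤ with interior-onto (2 ^ n) (encode J) code≢first code≢last
    where
    code≢first : toℕ (encode J) ≢ 0
    code≢first eq = J≢⊥ (encode-injective (Fin.toℕ-injective
      (≡-trans eq (≡-sym (toℕ-encode-⊥ n)))))
    code≢last : suc (toℕ (encode J)) ≢ 2 ^ n
    code≢last eq = J≢⊤ (encode-injective (Fin.toℕ-injective
      (ℕ.suc-injective (≡-trans eq (≡-sym (toℕ-encode-⊤ n))))))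
  ... | i , eq = i , ≡-trans (cong (decode n) eq) (decode-encode J)

  ≢⊥⇒Nonempty : ∀ {n} (J : Subset n) → J ≢ ⊥ → Nonempty J
  ≢⊥⇒Nonempty J J≢⊥ with nonempty? J
  ... | yes nonempty = nonempty
  ... | no empty     = contradiction (Empty-unique empty) J≢⊥

module RingFacts {c ℓ} (R : CommutativeRing c ℓ) where
  open CommutativeRing R renaming (refl to ≈-refl)
  open PerfectDivisors R
  open import Algebra.Properties.CommutativeSemigroup.Divisibility *-commutativeSemigroup
    using (_,_; x∣xy; x∣ʳy⇒x∣ʳzy)
  open import Algebra.Solver.Ring.NaturalCoefficients.Default commutativeSemiring
    using (solve; _:+_; _:*_; _:=_)

  coprime-1 : ∀ x → Coprime x 1#
  coprime-1 x = 0# , 1# , trans (+-cong (zeroˡ x) (*-identityˡ 1#)) (+-identityˡ 1#)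

  -- If a x + b y = 1 and c x + d z = 1, multiplying out gives a relation
  -- (a(c x + d z) + b y c) x + (b d)(y z) = 1.
  coprime-*ʳ : ∀ {x y z} → Coprime x y → Coprime x z → Coprime x (y * z)
  coprime-*ʳ {x} {y} {z} (a , b , ax+by≈1) (c′ , d , c′x+dz≈1) =
    a * (c′ * x + d * z) + b * y * c′ , b * d ,
    trans (sym (expand a b c′ d x y z)) (trans (*-cong ax+by≈1 c′x+dz≈1) (*-identityˡ 1#))
    where
    expand : ∀ a b c′ d x y z →
      (a * x + b * y) * (c′ * x + d * z) ≈ (a * (c′ * x + d * z) + b * y * c′) * x + (b * d) * (y * z)
    expand = solve 7 (λ a b c′ d x y z →
      (a :* x :+ b :* y) :* (c′ :* x :+ d :* z)
        := (a :* (c′ :* x :+ d :* z) :+ b :* y :* c′) :* x :+ (b :* d) :* (y :* z)) ≈-refl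

  -- A divisor x of y that is coprime to y is a unit: from q x = y and
  -- a x + b y = 1 we get (a + b q) x = 1.
  divisor-coprime⇒unit : ∀ {x y} → x ∣ y → Coprime x y → IsUnit x
  divisor-coprime⇒unit {x} (q , qx≈y) (a , b , ax+by≈1) =
    a + b * q , trans (expand a b q x) (trans (+-cong ≈-refl (*-cong ≈-refl qx≈y)) ax+by≈1)
    where
    expand : ∀ a b q x → (a + b * q) * x ≈ a * x + b * (q * x)
    expand = solve 4 (λ a b q x → (a :+ b :* q) :* x := a :* x :+ b :* (q :* x)) ≈-refl

  ∈⇒∣prodOver : ∀ {n} (ms : Fin n → Carrier) {i J} → i ∈ J → ms i ∣ prodOver ms J
  ∈⇒∣prodOver ms                     here          = x∣xy (ms Fin.zero) _
  ∈⇒∣prodOver ms {J = true  ∷ J} (there i∈J) = x∣ʳy⇒x∣ʳzy (ms Fin.zero) (∈⇒∣prodOver (ms ∘ Fin.suc) i∈J)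
  ∈⇒∣prodOver ms {J = false ∷ J} (there i∈J) = ∈⇒∣prodOver (ms ∘ Fin.suc) i∈J

  coprime-prodOver : ∀ {n} (ms : Fin n → Carrier) x (J : Subset n) →
                     (∀ {j} → j ∈ J → Coprime x (ms j)) → Coprime x (prodOver ms J)
  coprime-prodOver ms x []          _ = coprime-1 x
  coprime-prodOver ms x (true  ∷ J) h =
    coprime-*ʳ (h here) (coprime-prodOver (ms ∘ Fin.suc) x J (h ∘ there))
  coprime-prodOver ms x (false ∷ J) h = coprime-prodOver (ms ∘ Fin.suc) x J (h ∘ there)

module PerfectDivisorPoset {c ℓ} (R : CommutativeRing c ℓ) where
  open CommutativeRing R renaming (refl to ≈-refl)
  open PerfectDivisors R
  open RingFacts R
  open ProperSubsets
  open import Algebra.Properties.Monoid.Divisibility *-monoid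
    using (∣ʳ-trans; ∣ʳ-respˡ-≈; ∣ʳ-respʳ-≈; ∣ʳ-reflexive)

  ≤V-trans : ∀ {n} {ms : Fin n → Carrier} {a b d : PD ms} → a ≤V b → b ≤V d → a ≤V d
  ≤V-trans (inj₁ a≈b) (inj₁ b≈d) = inj₁ (trans a≈b b≈d)
  ≤V-trans (inj₁ a≈b) (inj₂ b∣d) = inj₂ (∣ʳ-respˡ-≈ (sym a≈b) b∣d)
  ≤V-trans (inj₂ a∣b) (inj₁ b≈d) = inj₂ (∣ʳ-respʳ-≈ b≈d a∣b)
  ≤V-trans (inj₂ a∣b) (inj₂ b∣d) = inj₂ (∣ʳ-trans a∣b b∣d)

  pdg≡comparabilityGraph : ∀ {n} {ms : Fin n → Carrier} (a b : PD ms) →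
                           PdgAdj a b ⇔ POGAdj _≤V_ a b
  pdg≡comparabilityGraph a b = mk⇔ to from
    where
    to : PdgAdj a b → POGAdj _≤V_ a b
    to (a≉b , inj₁ a∣b) = a≉b , inj₁ (inj₂ a∣b)
    to (a≉b , inj₂ b∣a) = a≉b , inj₂ (inj₂ b∣a)
    from : POGAdj _≤V_ a b → PdgAdj a b
    from (a≉b , inj₁ (inj₁ a≈b)) = contradiction a≈b a≉b
    from (a≉b , inj₁ (inj₂ a∣b)) = a≉b , inj₁ a∣b
    from (a≉b , inj₂ (inj₁ b≈a)) = contradiction (sym b≈a) a≉b
    from (a≉b , inj₂ (inj₂ b∣a)) = a≉b , inj₂ b∣a

  module CoprimeNonUnits {n} (ms : Fin n → Carrier)
           (pairwiseCoprime : ∀ i j → ¬ i ≡ j → Coprime (ms i) (ms j))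
           (nonUnit : ∀ i → ¬ IsUnit (ms i)) where

    -- The key fact: ∏_J mⱼ ∣ ∏_K mₖ forces J ⊆ K, since an index
    -- i ∈ J ∖ K would make mᵢ a divisor of ∏_K mₖ coprime to it.
    prodOver-∣⇒⊆ : ∀ {J K} → prodOver ms J ∣ prodOver ms K → J ⊆ K
    prodOver-∣⇒⊆ {J} {K} J∣K {i} i∈J with i ∈? K
    ... | yes i∈K = i∈K
    ... | no  i∉K = contradiction
      (divisor-coprime⇒unit (∣ʳ-trans (∈⇒∣prodOver ms i∈J) J∣K)
        (coprime-prodOver ms (ms i) K λ {j} j∈K →
          pairwiseCoprime i j λ { refl → i∉K j∈K }))
      (nonUnit i)

    prodOver-∣-antisym : ∀ {J K} → prodOver ms J ∣ prodOver ms K →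
                         prodOver ms K ∣ prodOver ms J → J ≡ K
    prodOver-∣-antisym J∣K K∣J = ⊆-antisym (prodOver-∣⇒⊆ J∣K) (prodOver-∣⇒⊆ K∣J)

    prodOver-injective : ∀ {J K} → prodOver ms J ≈ prodOver ms K → J ≡ K
    prodOver-injective J≈K = prodOver-∣-antisym (∣ʳ-reflexive J≈K) (∣ʳ-reflexive (sym J≈K))

    ≤V-antisym : ∀ {a b : PD ms} → a ≤V b → b ≤V a → a ≈V b
    ≤V-antisym (inj₁ a≈b) _          = a≈b
    ≤V-antisym (inj₂ _)   (inj₁ b≈a) = sym b≈a
    ≤V-antisym {a , _ , J , _ , a≈J} {b , _ , K , _ , b≈K} (inj₂ a∣b) (inj₂ b∣a) =
      trans a≈J (trans (reflexive (cong (prodOver ms) J≡K)) (sym b≈K))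
      where
      J≡K : J ≡ K
      J≡K = prodOver-∣-antisym (∣ʳ-respˡ-≈ a≈J (∣ʳ-respʳ-≈ b≈K a∣b))
                               (∣ʳ-respˡ-≈ b≈K (∣ʳ-respʳ-≈ a≈J b∣a))

    ≤V-isPartialOrder : IsPartialOrder (_≈V_ {ms = ms}) _≤V_
    ≤V-isPartialOrder = record
      { isPreorder = record
        { isEquivalence = record { refl = ≈-refl ; sym = sym ; trans = trans }
        ; reflexive     = inj₁
        ; trans         = λ {a} {b} {d} → ≤V-trans {a = a} {b} {d}
        }
      ; antisym = λ {a} {b} → ≤V-antisym {a} {b}
      }

    enumerate : Fin (2 ^ n ∸ 2) → PD ms
    enumerate i = prodOver ms J , J≉m , J , ≢⊥⇒Nonempty J (properSubset-≢⊥ n i) , ≈-refl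
      where
      J = properSubset n i
      J≉m : ¬ prodOver ms J ≈ totalProd ms
      J≉m = properSubset-≢⊤ n i ∘ prodOver-injective

    enumerate-injective : ∀ i j → enumerate i ≈V enumerate j → i ≡ j
    enumerate-injective i j = properSubset-injective n ∘ prodOver-injective

    enumerate-onto : ∀ v → ∃[ i ] (v ≈V enumerate i)
    enumerate-onto (d , d≉m , J , (x , x∈J) , d≈J)
      with properSubset-onto n J (λ { refl → ∉⊥ x∈J }) (λ { refl → d≉m d≈J })
    ... | i , i↦J = i , subst (λ L → d ≈ prodOver ms L) (≡-sym i↦J) d≈J

lemma3p2 : ∀ {c ℓ : Level} (R : CommutativeRing c ℓ) →
  let open CommutativeRing R
      open PerfectDivisors R
  in ¬ (1# ≈ 0#) →
     (n : ℕ) → 2 ≤ n →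
     (ms : Fin n → Carrier) →
     (∀ i j → ms i ≈ ms j → i ≡ j) →
     (∀ i j → ¬ i ≡ j → Coprime (ms i) (ms j)) →
     (∀ i → ¬ (ms i ≈ 0#)) →
     (∀ i → ¬ IsUnit (ms i)) →
     IsPartialOrder (_≈V_ {ms = ms}) _≤V_
     × (Σ (Fin (2 ^ n ∸ 2) → PD ms) λ f →
          (∀ i j → f i ≈V f j → i ≡ j) × (∀ v → ∃[ i ] (v ≈V f i)))
     × (Σ (PD ms → PD ms → Set (c ⊔ ℓ)) λ _⊑_ →
          IsPartialOrder (_≈V_ {ms = ms}) _⊑_
          × (∀ a b → PdgAdj a b ⇔ POGAdj _⊑_ a b))
lemma3p2 R _ n _ ms _ pairwiseCoprime _ nonUnit =
    ≤V-isPartialOrder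
  , (enumerate , enumerate-injective , enumerate-onto)
  , (_≤V_ , ≤V-isPartialOrder , pdg≡comparabilityGraph)
  where
  open PerfectDivisors R
  open PerfectDivisorPoset R
  open CoprimeNonUnits ms pairwiseCoprime nonUnit
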